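{- Let $1\le s\le r$ and $k\ge 0$ be integers, and let $\mathcal{K}=\langle K_1,\dots,K_r\rangle$ be an $r$-tuple of subcomplexes of $2^{[m]}$ such that either every $K_i$ is $(m,k)$-balanced, or (for a fixed coloring of $[m]$) every $K_i$ is $(m,k)$-rainbow balanced. For each $i$ let $\mathcal{A}^i=\{A^i_1,\dots,A^i_{l_i}\}$ be the relative complement $\Delta_{[m]}^{(k)}\setminus K_i$ in the balanced case, resp. $Col\Delta_{[m]}^{(k)}\setminus K_i$ in the rainbow balanced case (so each $|A^i_j|=k+1$). Let $\Gamma(\mathcal{K})$ be the graph with vertex set $\{(i,j): 1\le i\le r,\ 1\le j\le l_i\}$ in which $(i,j)$ and $(i',j')$ are adjacent iff $i\ne i'$ and $A^i_j\cap A^{i'}_{j'}=\emptyset$. If $\mathcal{K}$ is collectively $(r,s)$-unavoidable, then $\Gamma(\mathcal{K})$ contains no clique on $r-s+1$ vertices.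
   Context: $[m]=\{1,\dots,m\}$, $\Delta_{[m]}$ is identified with $2^{[m]}$ and $\Delta_{[m]}^{(j)}$ is the family of subsets of size at most $j+1$. $K$ is $(m,k)$-balanced if $\Delta_{[m]}^{(k-1)}\subseteq K\subseteq\Delta_{[m]}^{(k)}$. For a coloring $[m]=C_1\uplus\dots\uplus C_{k+1}$, a set is rainbow if it meets each $C_i$ in at most one element, $Col\Delta_{[m]}^{(j)}$ is the family of rainbow subsets of size at most $j+1$, and $K$ is $(m,k)$-rainbow balanced if $Col\Delta_{[m]}^{(k-1)}\subseteq K\subseteq Col\Delta_{[m]}^{(k)}$. An $r$-tuple $\langle K_1,\dots,K_r\rangle$ is collectively $(r,s)$-unavoidable if for every ordered collection $(A_1,\dots,A_r)$ of pairwise disjoint subsets of $[m]$ there are $s$ distinct indices $i_1,\dots,i_s$ with $A_{i_j}\in K_{i_j}$ for all $j$. -}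

module Defs where

open import Data.Nat using (ℕ; suc; _≤_; _∸_; _+_)
open import Data.Fin using (Fin)
open import Data.Fin.Subset using (Subset; _∈_; _∉_; _⊆_; ∣_∣)
open import Data.Product using (Σ; ∃; _×_)
open import Relation.Binary.PropositionalEquality using (_≡_; _≢_)
open import Relation.Nullary using (¬_)
open import Data.Empty using (⊥)

-- Subsets of [m] are  Subset m  (characteristic vectors over Fin m).
-- A family of subsets of [m] is a predicate on Subset m.
Family : ℕ → Set₁
Family m = Subset m → Set

IsComplex : ∀ {m} → Family m → Set
IsComplex {m} K = ∀ (A B : Subset m) → B ⊆ A → K A → K B

-- Δ_[m]^(j): subsets of size at most j+1.  We index by (j+1) =: n to allow j = -1.
-- SizeAtMost n A : |A| ≤ n
SizeAtMost : ∀ {m} → ℕ → Subset m → Set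
SizeAtMost n A = ∣ A ∣ ≤ n

Rainbow : ∀ {m q} → (Fin m → Fin q) → Subset m → Set
Rainbow c A = ∀ x y → x ∈ A → y ∈ A → c x ≡ c y → x ≡ y

-- The two settings: plain balanced, or rainbow balanced for a fixed
-- coloring [m] = C_1 ⊎ ... ⊎ C_{k+1}, given as a map into Fin (k+1).
data Setting (m k : ℕ) : Set where
  plain   : Setting m k
  colored : (Fin m → Fin (suc k)) → Setting m k

-- Faces of Δ^(j) (resp. ColΔ^(j)) with n = j + 1, i.e. size ≤ n.
Face : ∀ {m k} → Setting m k → ℕ → Subset m → Set
Face plain       n A = SizeAtMost n A
Face (colored c) n A = Rainbow c A × SizeAtMost n A

-- (m,k)-balanced / (m,k)-rainbow balanced:  Δ^(k-1) ⊆ K ⊆ Δ^(k)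
Balanced : ∀ {m k} → Setting m k → Family m → Set
Balanced {m} {k} σ K =
  (∀ A → Face σ k A → K A) × (∀ A → K A → Face σ (suc k) A)

-- the relative complement Δ^(k) \ K  (resp. ColΔ^(k) \ K)
InComplement : ∀ {m k} → Setting m k → Family m → Subset m → Set
InComplement {k = k} σ K A = Face σ (suc k) A × ¬ K A

Disjoint : ∀ {m} → Subset m → Subset m → Set
Disjoint A B = ∀ x → x ∈ A → x ∈ B → ⊥

CollectivelyUnavoidable : ∀ {m} (r s : ℕ) → (Fin r → Family m) → Set
CollectivelyUnavoidable {m} r s K =
  ∀ (A : Fin r → Subset m) →
  (∀ i i′ → i ≢ i′ → Disjoint (A i) (A i′)) →
  Σ (Fin s → Fin r) λ h →
    (∀ j j′ → h j ≡ h j′ → j ≡ j′) × (∀ j → K (h j) (A (h j)))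

-- Vertices of Γ(K): pairs (i , A) with A ∈ 𝒜^i (the complement of K_i).
-- Adjacent: i ≢ i′ and A ∩ A′ = ∅.
Adjacent : ∀ {m r} → (Fin r × Subset m) → (Fin r × Subset m) → Set
Adjacent (i Data.Product., A) (i′ Data.Product., A′) = i ≢ i′ × Disjoint A A′

HasClique : ∀ {m k r} → Setting m k → (Fin r → Family m) → ℕ → Set
HasClique {m} {k} {r} σ K n =
  Σ (Fin n → Fin r × Subset m) λ v →
    (∀ t → InComplement σ (K (Data.Product.proj₁ (v t))) (Data.Product.proj₂ (v t))) ×
    (∀ t t′ → v t ≡ v t′ → t ≡ t′) ×
    (∀ t t′ → t ≢ t′ → Adjacent (v t) (v t′))

-- The clique's vertices lie in distinct complexes K_g(t), t = 1, …, r−s+1, and their sets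
-- are pairwise disjoint.  Placing each set at its index and ∅ elsewhere gives an admissible
-- r-tuple, so unavoidability yields s indices i with A_i ∈ K_i.  None of them is a clique
-- index, since the clique's sets are missing from their complexes; hence
-- s + (r − s + 1) ≤ r, which is absurd.
module Submission where

open import Defs
open import Data.Nat using (ℕ; suc; _≤_; _<_; _∸_; _+_)
open import Data.Nat.Properties using (m+[n∸m]≡n; +-suc; ≤-reflexive; <⇒≱)
open import Data.Fin using (Fin; splitAt)
open import Data.Fin.Properties using (injective⇒≤; +↔⊎; any?) renaming (_≟_ to _≟ᶠ_)
open import Data.Fin.Subset using (Subset; _∈_; ⊥)
open import Data.Fin.Subset.Properties using (∉⊥)
open import Data.Product using (∃; _×_; _,_; proj₁; proj₂)
open import Data.Sum using (_⊎_; inj₁; inj₂; [_,_])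
open import Data.Empty using (⊥-elim)
open import Function using (_∘_; Injective; Injection)
open import Function.Properties.Inverse using (↔⇒↣)
open import Relation.Nullary using (¬_; yes; no)
open import Relation.Binary.PropositionalEquality using (_≡_; _≢_; refl; sym; trans; cong; subst)

private
  variable
    a b m n r : ℕ

[,]-injective : {A B C : Set} {f : A → C} {g : B → C} →
  Injective _≡_ _≡_ f → Injective _≡_ _≡_ g → (∀ x y → f x ≢ g y) →
  Injective _≡_ _≡_ [ f , g ]
[,]-injective f-inj g-inj f≢g {inj₁ x} {inj₁ x′} eq = cong inj₁ (f-inj eq)
[,]-injective f-inj g-inj f≢g {inj₁ x} {inj₂ y}  eq = ⊥-elim (f≢g x y eq)
[,]-injective f-inj g-inj f≢g {inj₂ y} {inj₁ x}  eq = ⊥-elim (f≢g x y (sym eq))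
[,]-injective f-inj g-inj f≢g {inj₂ y} {inj₂ y′} eq = cong inj₂ (g-inj eq)

disjoint-injections⇒+≤ : (f : Fin a → Fin r) (g : Fin b → Fin r) →
  Injective _≡_ _≡_ f → Injective _≡_ _≡_ g → (∀ i j → f i ≢ g j) → a + b ≤ r
disjoint-injections⇒+≤ {a} f g f-inj g-inj f≢g =
  injective⇒≤ {f = [ f , g ] ∘ splitAt a}
    (Injection.injective (↔⇒↣ +↔⊎) ∘ [,]-injective f-inj g-inj f≢g)

adjacent⇒index-injective : (v : Fin n → Fin r × Subset m) →
  (∀ t t′ → t ≢ t′ → Adjacent (v t) (v t′)) → Injective _≡_ _≡_ (proj₁ ∘ v)
adjacent⇒index-injective v adjacent {t} {t′} eq with t ≟ᶠ t′
... | yes t≡t′ = t≡t′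
... | no  t≢t′ = ⊥-elim (proj₁ (adjacent t t′ t≢t′) eq)

module Padding (g : Fin n → Fin r) (B : Fin n → Subset m) where

  pad : Fin r → Subset m
  pad i with any? (λ t → g t ≟ᶠ i)
  ... | yes (t , _) = B t
  ... | no  _       = ⊥

  pad-cases : ∀ i → (∃ λ t → g t ≡ i × pad i ≡ B t) ⊎ (∀ t → g t ≢ i) × pad i ≡ ⊥
  pad-cases i with any? (λ t → g t ≟ᶠ i)
  ... | yes (t , gt≡i) = inj₁ (t , gt≡i , refl)
  ... | no  ∄t         = inj₂ ((λ t gt≡i → ∄t (t , gt≡i)) , refl)

  pad-disjoint : (∀ t t′ → t ≢ t′ → Disjoint (B t) (B t′)) →
    ∀ i i′ → i ≢ i′ → Disjoint (pad i) (pad i′)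
  pad-disjoint B-disjoint i i′ i≢i′ x x∈i x∈i′
    with pad-cases i | pad-cases i′
  ... | inj₂ (_ , i≡⊥) | _ = ∉⊥ (subst (x ∈_) i≡⊥ x∈i)
  ... | inj₁ _ | inj₂ (_ , i′≡⊥) = ∉⊥ (subst (x ∈_) i′≡⊥ x∈i′)
  ... | inj₁ (t , gt≡i , i≡t) | inj₁ (t′ , gt′≡i′ , i′≡t′) =
    B-disjoint t t′ (λ t≡t′ → i≢i′ (trans (sym gt≡i) (trans (cong g t≡t′) gt′≡i′)))
      x (subst (x ∈_) i≡t x∈i) (subst (x ∈_) i′≡t′ x∈i′)

  pad-member⇒outside : (P : Fin r → Subset m → Set) → (∀ t → ¬ P (g t) (B t)) →
    ∀ i → P i (pad i) → ∀ t → g t ≢ i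
  pad-member⇒outside P ¬PB i Pi with pad-cases i
  ... | inj₁ (t , refl , i≡t) = ⊥-elim (¬PB t (subst (P (g t)) i≡t Pi))
  ... | inj₂ (∄t , _)         = ∄t

r<s+[1+r∸s] : ∀ {r s} → s ≤ r → r < s + suc (r ∸ s)
r<s+[1+r∸s] {r} {s} s≤r = ≤-reflexive (sym (trans (+-suc s (r ∸ s)) (cong suc (m+[n∸m]≡n s≤r))))

mainTheorem4 : ∀ (m k r s : ℕ) → 1 ≤ s → s ≤ r →
    (σ : Setting m k) → (K : Fin r → Family m) →
    (∀ i → IsComplex (K i)) → (∀ i → Balanced σ (K i)) →
    CollectivelyUnavoidable r s K →
    ¬ HasClique σ K (suc (r ∸ s))
mainTheorem4 m k r s _ s≤r σ K _ _ unavoidable (v , inComplement , _ , adjacent) =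
  let (h , h-inj , h∈K) = unavoidable pad (pad-disjoint (λ t t′ → proj₂ ∘ adjacent t t′))
      h≢g : ∀ j t → h j ≢ g t
      h≢g j t hj≡gt = pad-member⇒outside K (proj₂ ∘ inComplement) (h j) (h∈K j) t (sym hj≡gt)
  in <⇒≱ (r<s+[1+r∸s] s≤r) (disjoint-injections⇒+≤ h g (h-inj _ _) g-inj h≢g)
  where
  g : Fin (suc (r ∸ s)) → Fin r
  g = proj₁ ∘ v
  open Padding g (proj₂ ∘ v)
  g-inj : Injective _≡_ _≡_ g
  g-inj = adjacent⇒index-injective v adjacent
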